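{- Let $G=(V,E)$ be a graph and $[W,F]$ a non-maximal utter clique of $G$. Then the inequality $x(W)+y(F\cap E(V\setminus W))-y(E(W))\le 1$ is dominated by (i.e. implied by) the system \begin{align*} x(W')+y(F'\cap E(V\setminus W'))-y(E(W'))&\le 1 &&\text{for all maximal utter cliques } [W',F'] \text{ of } G,\\ y(\delta(v))&\le x_v &&\text{for all } v\in V,\\ -y_e&\le 0 &&\text{for all } e\in E. \end{align*}
   Context: $E(W)$ is the set of edges with both endpoints in $W$, $\delta(v)$ the set of edges incident to $v$, $x(S)=\sum_{s\in S}x_s$. The utter graph $u(G)$ has vertex set $V\cup E$; two vertices of $G$ are adjacent in $u(G)$ iff adjacent in $G$; a vertex $w$ and an edge $uv$ are adjacent iff $w\in\{u,v\}$ or $w$ is adjacent in $G$ to $u$ or $v$; two edges are adjacent iff they share an endpoint, or are disjoint and some edge of $G$ joins an endpoint of one to an endpoint of the other. $[W,F]$ ($W\subseteq V$, $F\subseteq E$) is an utter clique if $W\cup F$ is a clique of $u(G)$, maximal if no element can be added to $W$ or $F$ keeping this property.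
   Formalization: The points (x,y) at which the system and the inequality are compared have rational coordinates, ranging over ℚ^V × ℚ^E instead of ℝ^V × ℝ^E. -}

module Defs where

open import Data.Nat using (ℕ; zero; suc)
open import Data.Fin using (Fin; zero; suc; _<_; _<?_; _≟_)
open import Data.Bool using (Bool; true; false; if_then_else_; _∧_; _∨_; not)
open import Data.Rational using (ℚ; 0ℚ; 1ℚ; _+_; _-_; _≤_)
open import Data.Product using (Σ; ∃; _×_; _,_)
open import Data.Sum using (_⊎_)
open import Relation.Nullary using (¬_; yes; no)
open import Relation.Binary.PropositionalEquality using (_≡_; _≢_)

record Graph (n : ℕ) : Set where
  field
    adj   : Fin n → Fin n → Bool
    sym   : ∀ u v → adj u v ≡ adj v u
    irref : ∀ u → adj u u ≡ false
open Graph public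

-- An edge uv of G, stored with u < v (so each edge appears exactly once).
record Edge {n : ℕ} (G : Graph n) : Set where
  constructor edge
  field
    src   : Fin n
    tgt   : Fin n
    ord   : src < tgt
    isAdj : adj G src tgt ≡ true
open Edge public

Adj : ∀ {n} → Graph n → Fin n → Fin n → Set
Adj G u v = adj G u v ≡ true

VSet : ℕ → Set
VSet n = Fin n → Bool

ESet : ∀ {n} → Graph n → Set
ESet G = Edge G → Bool

sumFin : ∀ n → (Fin n → ℚ) → ℚ
sumFin zero    f = 0ℚ
sumFin (suc n) f = f zero + sumFin n (λ i → f (suc i))

sumE : ∀ {n} (G : Graph n) → (Edge G → ℚ) → ℚ
sumE {n} G f = sumFin n (λ u → sumFin n (λ v → term u v))
  where
  term : Fin n → Fin n → ℚ
  term u v with u <? v | adj G u v Data.Bool.≟ true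
  ... | yes p | yes q = f (edge u v p q)
  ... | _     | _     = 0ℚ

xOf : ∀ {n} → (Fin n → ℚ) → VSet n → ℚ
xOf {n} x S = sumFin n (λ v → if S v then x v else 0ℚ)

yOf : ∀ {n} {G : Graph n} → (Edge G → ℚ) → ESet G → ℚ
yOf {G = G} y T = sumE G (λ e → if T e then y e else 0ℚ)

EIn : ∀ {n} {G : Graph n} → VSet n → ESet G
EIn W e = W (src e) ∧ W (tgt e)

compl : ∀ {n} → VSet n → VSet n
compl W v = not (W v)

_∩E_ : ∀ {n} {G : Graph n} → ESet G → ESet G → ESet G
(A ∩E B) e = A e ∧ B e

δ : ∀ {n} {G : Graph n} → Fin n → ESet G
δ v e = (⌊ src e ≟ v ⌋) ∨ (⌊ tgt e ≟ v ⌋)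
  where open import Relation.Nullary.Decidable using (⌊_⌋)

cliqueLHS : ∀ {n} {G : Graph n} → (Fin n → ℚ) → (Edge G → ℚ) → VSet n → ESet G → ℚ
cliqueLHS x y W F = (xOf x W + yOf y (F ∩E EIn (compl W))) - yOf y (EIn W)

-- Adjacency in the utter graph u(G).
-- vertex–vertex: adjacent in G.
-- vertex w and edge uv: w ∈ {u,v} or w adjacent in G to u or v.
UVE : ∀ {n} (G : Graph n) → Fin n → Edge G → Set
UVE G w e = (w ≡ src e ⊎ w ≡ tgt e) ⊎ (Adj G w (src e) ⊎ Adj G w (tgt e))

Endpoint : ∀ {n} {G : Graph n} → Fin n → Edge G → Set
Endpoint a e = a ≡ src e ⊎ a ≡ tgt e

UEE : ∀ {n} (G : Graph n) → Edge G → Edge G → Set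
UEE G e f =
  (∃ λ a → Endpoint a e × Endpoint a f)
  ⊎ ((¬ ∃ λ a → Endpoint a e × Endpoint a f)
     × ∃ λ a → ∃ λ b → Endpoint a e × Endpoint b f × Adj G a b)

-- [W,F] is an utter clique: W ∪ F is a clique of u(G).
IsUtterClique : ∀ {n} (G : Graph n) → VSet n → ESet G → Set
IsUtterClique G W F =
  (∀ u v → W u ≡ true → W v ≡ true → u ≢ v → Adj G u v)
  × (∀ w e → W w ≡ true → F e ≡ true → UVE G w e)
  × (∀ e f → F e ≡ true → F f ≡ true → e ≢ f → UEE G e f)

insV : ∀ {n} → Fin n → VSet n → VSet n
insV v W u with u ≟ v
... | yes _ = true
... | no  _ = W u

insE : ∀ {n} {G : Graph n} → Edge G → ESet G → ESet G
insE e F f = F f ∨ (f ≡ᵇ e)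
  where
  open import Data.Fin using () renaming (_≟_ to _≟F_)
  _≡ᵇ_ : Edge _ → Edge _ → Bool
  f' ≡ᵇ e' = ⌊ src f' ≟F src e' ⌋ ∧ ⌊ tgt f' ≟F tgt e' ⌋
    where open import Relation.Nullary.Decidable using (⌊_⌋)

IsMaximalUtterClique : ∀ {n} (G : Graph n) → VSet n → ESet G → Set
IsMaximalUtterClique G W F =
  IsUtterClique G W F
  × (∀ v → W v ≡ false → ¬ IsUtterClique G (insV v W) F)
  × (∀ e → F e ≡ false → ¬ IsUtterClique G W (insE e F))

SatisfiesSystem : ∀ {n} (G : Graph n) → (Fin n → ℚ) → (Edge G → ℚ) → Set
SatisfiesSystem G x y =
  (∀ W' F' → IsMaximalUtterClique G W' F' → cliqueLHS x y W' F' ≤ 1ℚ)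
  × (∀ v → yOf y (δ v) ≤ x v)
  × (∀ e → 0ℚ ≤ y e)

{-# OPTIONS --safe #-}
-- Greedily insert vertices and then edges into [W,F] while it stays an utter
-- clique; this ends in a maximal utter clique [W',F'], and the left-hand side
-- never decreases along the way. Inserting an edge into F only adds a term
-- y_e ≥ 0. Inserting a vertex v adds x_v and lowers the coefficient of y_e by
-- at most 1, and only for e ∈ δ(v), so it costs at most y(δ(v)) ≤ x_v.
-- Being an utter clique is not decided here, so [W',F'] is obtained under
-- double negation only; this suffices because ≤ on ℚ is decidable.
module Submission where

open import Defs
open import Data.Nat using (ℕ; zero; suc)
open import Data.Fin using (Fin; zero; suc; _<_; _<?_; _≟_)
open import Data.Fin.Properties using (<-irrelevant; <⇒≢)
open import Data.Bool using (Bool; true; false; if_then_else_; _∧_; _∨_; not)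
import Data.Bool as Bool
open import Data.Bool.Properties using (∨-zeroʳ; not-¬)
open import Data.Rational using (ℚ; 0ℚ; 1ℚ; _+_; _-_; -_; _≤_)
open import Data.Rational.Properties
  using (module ≤-Reasoning; ≤-refl; ≤-reflexive; ≤-trans; ≤-antisym; _≤?_;
         +-mono-≤; +-monoʳ-≤; +-assoc; +-identityˡ; +-identityʳ; +-inverseˡ)
open import Data.Rational.Solver using (module +-*-Solver)
open import Data.Product using (∃; _×_; _,_)
open import Data.List using (List; []; _∷_; allFin; cartesianProduct; concatMap)
open import Data.List.Membership.Propositional using (_∈_; lose)
open import Data.List.Membership.Propositional.Properties
  using (∈-allFin; ∈-cartesianProduct⁺; ∈-concatMap⁺)
open import Data.List.Relation.Unary.Any using (here; there)
open import Relation.Nullary using (¬_; yes; no)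
open import Relation.Nullary.Decidable using (⌊_⌋; ⌊⌋-map′; decidable-stable; ¬¬-excluded-middle)
open import Relation.Nullary.Negation using (¬¬-Monad; ¬¬-map; contradiction)
open import Relation.Nullary.Negation.Core using (DoubleNegation)
open import Effect.Monad using (RawMonad)
open import Level using (0ℓ)
open import Relation.Binary.PropositionalEquality using (_≡_; refl; cong; cong₂; trans)
import Relation.Binary.PropositionalEquality as ≡
open import Axiom.UniquenessOfIdentityProofs using (module Decidable⇒UIP)

select : Bool → ℚ → ℚ
select b r = if b then r else 0ℚ

sumFin-cong : ∀ n {f g : Fin n → ℚ} → (∀ i → f i ≡ g i) → sumFin n f ≡ sumFin n g
sumFin-cong zero    f≗g = refl
sumFin-cong (suc n) f≗g = cong₂ _+_ (f≗g zero) (sumFin-cong n (λ i → f≗g (suc i)))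

sumFin-mono : ∀ n {f g : Fin n → ℚ} → (∀ i → f i ≤ g i) → sumFin n f ≤ sumFin n g
sumFin-mono zero    f≤g = ≤-refl
sumFin-mono (suc n) f≤g = +-mono-≤ (f≤g zero) (sumFin-mono n (λ i → f≤g (suc i)))

sumFin-distrib : (_⊙_ : ℚ → ℚ → ℚ) → 0ℚ ⊙ 0ℚ ≡ 0ℚ →
  (∀ a b c d → (a + b) ⊙ (c + d) ≡ (a ⊙ c) + (b ⊙ d)) →
  ∀ n (f g : Fin n → ℚ) → sumFin n (λ i → f i ⊙ g i) ≡ sumFin n f ⊙ sumFin n g
sumFin-distrib _⊙_ 0⊙0 interchange zero    f g = ≡.sym 0⊙0
sumFin-distrib _⊙_ 0⊙0 interchange (suc n) f g =
  trans (cong (f zero ⊙ g zero +_)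
               (sumFin-distrib _⊙_ 0⊙0 interchange n (λ i → f (suc i)) (λ i → g (suc i))))
        (≡.sym (interchange _ _ _ _))

sumFin-select-≟ : ∀ n (f : Fin n → ℚ) v → sumFin n (λ u → select ⌊ u ≟ v ⌋ (f u)) ≡ f v
sumFin-select-≟ (suc n) f zero    = trans (cong (f zero +_) (sumFin-zero n)) (+-identityʳ (f zero))
  where
  sumFin-zero : ∀ n → sumFin n (λ _ → 0ℚ) ≡ 0ℚ
  sumFin-zero zero    = refl
  sumFin-zero (suc n) = cong (0ℚ +_) (sumFin-zero n)
sumFin-select-≟ (suc n) f (suc v) = begin
  0ℚ + sumFin n (λ i → select ⌊ suc i ≟ suc v ⌋ (f (suc i)))
    ≡⟨ +-identityˡ _ ⟩
  sumFin n (λ i → select ⌊ suc i ≟ suc v ⌋ (f (suc i)))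
    ≡⟨ sumFin-cong n (λ i → cong (λ b → select b (f (suc i))) (⌊⌋-map′ _ _ (i ≟ v))) ⟩
  sumFin n (λ i → select ⌊ i ≟ v ⌋ (f (suc i)))
    ≡⟨ sumFin-select-≟ n (λ i → f (suc i)) v ⟩
  f (suc v) ∎
  where open ≡.≡-Reasoning

open +-*-Solver

+-interchange : ∀ a b c d → (a + b) + (c + d) ≡ (a + c) + (b + d)
+-interchange = solve 4 (λ a b c d → (a :+ b) :+ (c :+ d) := (a :+ c) :+ (b :+ d)) refl

-‿interchange : ∀ a b c d → (a + b) - (c + d) ≡ (a - c) + (b - d)
-‿interchange = solve 4 (λ a b c d → (a :+ b) :- (c :+ d) := (a :- c) :+ (b :- d)) refl

module _ {n} (G : Graph n) where

  edgeTerm : (Edge G → ℚ) → Fin n → Fin n → ℚ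
  edgeTerm f u v with u <? v | adj G u v Bool.≟ true
  ... | yes u<v | yes uv = f (edge u v u<v uv)
  ... | _       | _      = 0ℚ

  sumE-edgeTerm : (f : Edge G → ℚ) → sumE G f ≡ sumFin n (λ u → sumFin n (edgeTerm f u))
  sumE-edgeTerm f = sums
    where
    -- The summand of sumE is local to Defs and cannot be named; the left-hand
    -- side below is inferred from its use in sums.
    summand≡edgeTerm : ∀ u v → _ ≡ edgeTerm f u v
    sums : sumE G f ≡ sumFin n (λ u → sumFin n (edgeTerm f u))
    sums = sumFin-cong n (λ u → sumFin-cong n (summand≡edgeTerm u))
    summand≡edgeTerm u v with u <? v | adj G u v Bool.≟ true
    ... | yes _ | yes _ = refl
    ... | yes _ | no _  = refl
    ... | no _  | _     = refl

  sumE-distrib : (_⊙_ : ℚ → ℚ → ℚ) → 0ℚ ⊙ 0ℚ ≡ 0ℚ →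
    (∀ a b c d → (a + b) ⊙ (c + d) ≡ (a ⊙ c) + (b ⊙ d)) →
    (f g : Edge G → ℚ) → sumE G (λ e → f e ⊙ g e) ≡ sumE G f ⊙ sumE G g
  sumE-distrib _⊙_ 0⊙0 interchange f g = begin
    sumE G (λ e → f e ⊙ g e)
      ≡⟨ sumE-edgeTerm _ ⟩
    sumFin n (λ u → sumFin n (edgeTerm (λ e → f e ⊙ g e) u))
      ≡⟨ sumFin-cong n (λ u → sumFin-cong n (edgeTerm-distrib u)) ⟩
    sumFin n (λ u → sumFin n (λ v → edgeTerm f u v ⊙ edgeTerm g u v))
      ≡⟨ sumFin-cong n (λ u → sumFin-distrib _⊙_ 0⊙0 interchange n (edgeTerm f u) (edgeTerm g u)) ⟩
    sumFin n (λ u → sumFin n (edgeTerm f u) ⊙ sumFin n (edgeTerm g u))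
      ≡⟨ sumFin-distrib _⊙_ 0⊙0 interchange n _ _ ⟩
    sumFin n (λ u → sumFin n (edgeTerm f u)) ⊙ sumFin n (λ u → sumFin n (edgeTerm g u))
      ≡⟨ ≡.sym (cong₂ _⊙_ (sumE-edgeTerm f) (sumE-edgeTerm g)) ⟩
    sumE G f ⊙ sumE G g ∎
    where
    open ≡.≡-Reasoning
    edgeTerm-distrib : ∀ u v → edgeTerm (λ e → f e ⊙ g e) u v ≡ edgeTerm f u v ⊙ edgeTerm g u v
    edgeTerm-distrib u v with u <? v | adj G u v Bool.≟ true
    ... | yes _ | yes _ = refl
    ... | yes _ | no _  = ≡.sym 0⊙0
    ... | no _  | _     = ≡.sym 0⊙0

  sumE-mono : {f g : Edge G → ℚ} → (∀ e → f e ≤ g e) → sumE G f ≤ sumE G g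
  sumE-mono {f} {g} f≤g
    rewrite sumE-edgeTerm f | sumE-edgeTerm g
    = sumFin-mono n (λ u → sumFin-mono n (edgeTerm-mono u))
    where
    edgeTerm-mono : ∀ u v → edgeTerm f u v ≤ edgeTerm g u v
    edgeTerm-mono u v with u <? v | adj G u v Bool.≟ true
    ... | yes _ | yes _ = f≤g _
    ... | yes _ | no _  = ≤-refl
    ... | no _  | _     = ≤-refl

  sumE-cong : {f g : Edge G → ℚ} → (∀ e → f e ≡ g e) → sumE G f ≡ sumE G g
  sumE-cong f≗g =
    ≤-antisym (sumE-mono (λ e → ≤-reflexive (f≗g e)))
              (sumE-mono (λ e → ≤-reflexive (≡.sym (f≗g e))))

select-nonNeg : ∀ b {r} → 0ℚ ≤ r → 0ℚ ≤ select b r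
select-nonNeg true  0≤r = 0≤r
select-nonNeg false 0≤r = ≤-refl

select-≤ : ∀ b {r} → 0ℚ ≤ r → select b r ≤ r
select-≤ true  0≤r = ≤-refl
select-≤ false 0≤r = 0≤r

select-mono : ∀ {b b′} {r} → (b ≡ true → b′ ≡ true) → 0ℚ ≤ r → select b r ≤ select b′ r
select-mono {true}  b⇒b′ 0≤r rewrite b⇒b′ refl = ≤-refl
select-mono {false} {b′} b⇒b′ 0≤r = select-nonNeg b′ 0≤r

xOf-insV : ∀ {n} (x : Fin n → ℚ) (W : VSet n) v → W v ≡ false → xOf x (insV v W) ≡ xOf x W + x v
xOf-insV {n} x W v Wv≡false = begin
  xOf x (insV v W)
    ≡⟨ sumFin-cong n split ⟩
  sumFin n (λ u → select (W u) (x u) + select ⌊ u ≟ v ⌋ (x u))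
    ≡⟨ sumFin-distrib _+_ refl +-interchange n _ _ ⟩
  xOf x W + sumFin n (λ u → select ⌊ u ≟ v ⌋ (x u))
    ≡⟨ cong (xOf x W +_) (sumFin-select-≟ n x v) ⟩
  xOf x W + x v ∎
  where
  open ≡.≡-Reasoning
  split : ∀ u → select (insV v W u) (x u) ≡ select (W u) (x u) + select ⌊ u ≟ v ⌋ (x u)
  split u with u ≟ v
  ... | yes refl rewrite Wv≡false = ≡.sym (+-identityˡ (x u))
  ... | no _     = ≡.sym (+-identityʳ _)

-- The coefficient of y_e in x(W) + y(F ∩ E(V∖W)) − y(E(W)), given whether
-- e ∈ F, src e ∈ W and tgt e ∈ W.
edgeWeight : Bool → Bool → Bool → ℚ → ℚ
edgeWeight inF false false r = select inF r
edgeWeight inF true  true  r = - r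
edgeWeight inF _     _     r = 0ℚ

edgeWeight-select : ∀ inF ws wt r →
  select (inF ∧ (not ws ∧ not wt)) r - select (ws ∧ wt) r ≡ edgeWeight inF ws wt r
edgeWeight-select true  false false r = +-identityʳ r
edgeWeight-select false false false r = refl
edgeWeight-select true  true  true  r = +-identityˡ (- r)
edgeWeight-select false true  true  r = +-identityˡ (- r)
edgeWeight-select true  true  false r = refl
edgeWeight-select false true  false r = refl
edgeWeight-select true  false true  r = refl
edgeWeight-select false false true  r = refl

edgeWeight-mono : ∀ {inF inF′} ws wt {r} → (inF ≡ true → inF′ ≡ true) → 0ℚ ≤ r →
  edgeWeight inF ws wt r ≤ edgeWeight inF′ ws wt r
edgeWeight-mono false false inF⇒inF′ 0≤r = select-mono inF⇒inF′ 0≤r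
edgeWeight-mono true  true  inF⇒inF′ 0≤r = ≤-refl
edgeWeight-mono true  false inF⇒inF′ 0≤r = ≤-refl
edgeWeight-mono false true  inF⇒inF′ 0≤r = ≤-refl

edgeWeight-insˡ : ∀ inF w {r} → 0ℚ ≤ r → edgeWeight inF false w r ≤ edgeWeight inF true w r + r
edgeWeight-insˡ inF false {r} 0≤r = ≤-trans (select-≤ inF 0≤r) (≤-reflexive (≡.sym (+-identityˡ r)))
edgeWeight-insˡ inF true  {r} 0≤r = ≤-reflexive (≡.sym (+-inverseˡ r))

edgeWeight-insʳ : ∀ inF w {r} → 0ℚ ≤ r → edgeWeight inF w false r ≤ edgeWeight inF w true r + r
edgeWeight-insʳ inF false {r} 0≤r = ≤-trans (select-≤ inF 0≤r) (≤-reflexive (≡.sym (+-identityˡ r)))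
edgeWeight-insʳ inF true  {r} 0≤r = ≤-reflexive (≡.sym (+-inverseˡ r))

_⊆_ : {A : Set} → (A → Bool) → (A → Bool) → Set
X ⊆ Y = ∀ a → X a ≡ true → Y a ≡ true

⊆-refl : {A : Set} {X : A → Bool} → X ⊆ X
⊆-refl a Xa = Xa

module _ {n} {G : Graph n} (x : Fin n → ℚ) (y : Edge G → ℚ) where

  edgeWeights : VSet n → ESet G → ℚ
  edgeWeights W F = sumE G (λ e → edgeWeight (F e) (W (src e)) (W (tgt e)) (y e))

  cliqueLHS-edgeWeights : ∀ W F → cliqueLHS x y W F ≡ xOf x W + edgeWeights W F
  cliqueLHS-edgeWeights W F = begin
    (xOf x W + yOf y (F ∩E EIn (compl W))) - yOf y (EIn W)
      ≡⟨ +-assoc (xOf x W) _ _ ⟩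
    xOf x W + (yOf y (F ∩E EIn (compl W)) - yOf y (EIn W))
      ≡⟨ cong (xOf x W +_) (≡.sym (sumE-distrib G _-_ refl -‿interchange _ _)) ⟩
    xOf x W + sumE G (λ e → select ((F ∩E EIn (compl W)) e) (y e) - select (EIn W e) (y e))
      ≡⟨ cong (xOf x W +_) (sumE-cong G (λ e → edgeWeight-select (F e) (W (src e)) (W (tgt e)) (y e))) ⟩
    xOf x W + edgeWeights W F ∎
    where open ≡.≡-Reasoning

  module _ (y≥0 : ∀ e → 0ℚ ≤ y e) where

    cliqueLHS-monoʳ : ∀ W {F F′} → F ⊆ F′ → cliqueLHS x y W F ≤ cliqueLHS x y W F′
    cliqueLHS-monoʳ W {F} {F′} F⊆F′ = begin
      cliqueLHS x y W F           ≡⟨ cliqueLHS-edgeWeights W F ⟩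
      xOf x W + edgeWeights W F   ≤⟨ +-monoʳ-≤ (xOf x W) (sumE-mono G weight-mono) ⟩
      xOf x W + edgeWeights W F′  ≡⟨ ≡.sym (cliqueLHS-edgeWeights W F′) ⟩
      cliqueLHS x y W F′          ∎
      where
      open ≤-Reasoning
      weight-mono : ∀ e → edgeWeight (F e) (W (src e)) (W (tgt e)) (y e)
                        ≤ edgeWeight (F′ e) (W (src e)) (W (tgt e)) (y e)
      weight-mono e = edgeWeight-mono (W (src e)) (W (tgt e)) (F⊆F′ e) (y≥0 e)

    edgeWeight-insV : ∀ W (F : ESet G) v (e : Edge G) → W v ≡ false →
      edgeWeight (F e) (W (src e)) (W (tgt e)) (y e)
        ≤ edgeWeight (F e) (insV v W (src e)) (insV v W (tgt e)) (y e) + select (δ v e) (y e)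
    edgeWeight-insV W F v e Wv≡false with src e ≟ v | tgt e ≟ v
    ... | yes refl | yes tgt≡src = contradiction (≡.sym tgt≡src) (<⇒≢ (ord e))
    ... | yes refl | no _ rewrite Wv≡false = edgeWeight-insˡ (F e) (W (tgt e)) (y≥0 e)
    ... | no _ | yes refl rewrite Wv≡false = edgeWeight-insʳ (F e) (W (src e)) (y≥0 e)
    ... | no _ | no _ = ≤-reflexive (≡.sym (+-identityʳ (edgeWeight (F e) (W (src e)) (W (tgt e)) (y e))))

    cliqueLHS-insV : ∀ W (F : ESet G) v → W v ≡ false → yOf y (δ v) ≤ x v →
      cliqueLHS x y W F ≤ cliqueLHS x y (insV v W) F
    cliqueLHS-insV W F v Wv≡false δv≤xv = begin
      cliqueLHS x y W F
        ≡⟨ cliqueLHS-edgeWeights W F ⟩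
      xOf x W + edgeWeights W F
        ≤⟨ +-monoʳ-≤ (xOf x W) (sumE-mono G (λ e → edgeWeight-insV W F v e Wv≡false)) ⟩
      xOf x W + sumE G (λ e → edgeWeight (F e) (W′ (src e)) (W′ (tgt e)) (y e) + select (δ v e) (y e))
        ≡⟨ cong (xOf x W +_) (sumE-distrib G _+_ refl +-interchange _ _) ⟩
      xOf x W + (edgeWeights W′ F + yOf y (δ v))
        ≤⟨ +-monoʳ-≤ (xOf x W) (+-monoʳ-≤ (edgeWeights W′ F) δv≤xv) ⟩
      xOf x W + (edgeWeights W′ F + x v)
        ≡⟨ rearrange (xOf x W) (edgeWeights W′ F) (x v) ⟩
      (xOf x W + x v) + edgeWeights W′ F
        ≡⟨ cong (_+ edgeWeights W′ F) (≡.sym (xOf-insV x W v Wv≡false)) ⟩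
      xOf x W′ + edgeWeights W′ F
        ≡⟨ ≡.sym (cliqueLHS-edgeWeights W′ F) ⟩
      cliqueLHS x y W′ F ∎
      where
      open ≤-Reasoning
      W′ : VSet n
      W′ = insV v W
      rearrange : ∀ a b c → a + (b + c) ≡ (a + c) + b
      rearrange = solve 3 (λ a b c → a :+ (b :+ c) := (a :+ c) :+ b) refl

∨-monoˡ-true : ∀ {a a′} b → (a ≡ true → a′ ≡ true) → a ∨ b ≡ true → a′ ∨ b ≡ true
∨-monoˡ-true {true}       b a⇒a′ _   rewrite a⇒a′ refl = refl
∨-monoˡ-true {false} {a′} b a⇒a′ b≡t rewrite b≡t = ∨-zeroʳ a′

module _ {n : ℕ} where

  insV-self : ∀ v (W : VSet n) → insV v W v ≡ true
  insV-self v W with v ≟ v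
  ... | yes _   = refl
  ... | no v≢v  = contradiction refl v≢v

  ⊆-insV : ∀ v (W : VSet n) → W ⊆ insV v W
  ⊆-insV v W u Wu with u ≟ v
  ... | yes _ = refl
  ... | no _  = Wu

  insV-mono : ∀ v {W W′ : VSet n} → W ⊆ W′ → insV v W ⊆ insV v W′
  insV-mono v W⊆W′ u with u ≟ v
  ... | yes _ = λ _ → refl
  ... | no _  = W⊆W′ u

module _ {n} {G : Graph n} where

  insE-self : ∀ (e : Edge G) F → insE e F e ≡ true
  insE-self e F with src e ≟ src e | tgt e ≟ tgt e
  ... | yes _ | yes _ = ∨-zeroʳ (F e)
  ... | no ≢  | _     = contradiction refl ≢
  ... | _     | no ≢  = contradiction refl ≢

  ⊆-insE : ∀ (e : Edge G) F → F ⊆ insE e F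
  ⊆-insE e F f Ff rewrite Ff = refl

  insE-mono : ∀ (e : Edge G) {F F′} → F ⊆ F′ → insE e F ⊆ insE e F′
  insE-mono e F⊆F′ f = ∨-monoˡ-true _ (F⊆F′ f)

  IsUtterClique-anti : ∀ {W W′ : VSet n} {F F′ : ESet G} → W ⊆ W′ → F ⊆ F′ →
    IsUtterClique G W′ F′ → IsUtterClique G W F
  IsUtterClique-anti W⊆W′ F⊆F′ (vv , ve , ee) =
    (λ u v Wu Wv → vv u v (W⊆W′ u Wu) (W⊆W′ v Wv)) ,
    (λ w e Ww Fe → ve w e (W⊆W′ w Ww) (F⊆F′ e Fe)) ,
    (λ e f Fe Ff → ee e f (F⊆F′ e Fe) (F⊆F′ f Ff))

open RawMonad (¬¬-Monad {a = 0ℓ}) using (pure; _>>=_)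

module Saturation {A : Set} (ins : A → (A → Bool) → (A → Bool))
  (ins-self : ∀ a X → ins a X a ≡ true)
  (⊆-ins : ∀ a X → X ⊆ ins a X)
  (ins-mono : ∀ a {X Y} → X ⊆ Y → ins a X ⊆ ins a Y)
  (Feasible : (A → Bool) → Set) (Feasible-anti : ∀ {X Y} → X ⊆ Y → Feasible Y → Feasible X)
  (Inv : (A → Bool) → Set) (Inv-ins : ∀ a X → X a ≡ false → Inv X → Inv (ins a X))
  where

  Saturated : List A → (A → Bool) → Set
  Saturated as Y = ∀ a → a ∈ as → Y a ≡ false → ¬ Feasible (ins a Y)

  saturate : ∀ as X → Feasible X → Inv X →
    DoubleNegation (∃ λ Y → X ⊆ Y × Feasible Y × Inv Y × Saturated as Y)
  saturate []       X fX iX = pure (X , ⊆-refl , fX , iX , λ _ ())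
  saturate (a ∷ as) X fX iX with X a in Xa≡
  ... | true = do
    (Y , X⊆Y , fY , iY , satY) ← saturate as X fX iX
    pure (Y , X⊆Y , fY , iY , λ where
      b (here refl)  Yb≡false → contradiction Yb≡false (not-¬ (X⊆Y b Xa≡))
      b (there b∈as)          → satY b b∈as)
  ... | false = ¬¬-excluded-middle >>= λ where
    (yes fXa) → do
      (Y , Xa⊆Y , fY , iY , satY) ← saturate as (ins a X) fXa (Inv-ins a X Xa≡ iX)
      pure (Y , (λ b Xb → Xa⊆Y b (⊆-ins a X b Xb)) , fY , iY , λ where
        b (here refl)  Yb≡false → contradiction Yb≡false (not-¬ (Xa⊆Y b (ins-self b X)))
        b (there b∈as)          → satY b b∈as)
    (no ¬fXa) → do
      (Y , X⊆Y , fY , iY , satY) ← saturate as X fX iX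
      pure (Y , X⊆Y , fY , iY , λ where
        b (here refl)  _ fYb → ¬fXa (Feasible-anti (ins-mono b X⊆Y) fYb)
        b (there b∈as)       → satY b b∈as)

module _ {n} (G : Graph n) where

  edge-≡ : ∀ (e : Edge G) (p : src e < tgt e) (q : Adj G (src e) (tgt e)) →
    e ≡ edge (src e) (tgt e) p q
  edge-≡ e p q = cong₂ (edge (src e) (tgt e))
    (<-irrelevant (ord e) p) (Decidable⇒UIP.≡-irrelevant Bool._≟_ (isAdj e) q)

  edgesBetween : Fin n × Fin n → List (Edge G)
  edgesBetween (u , v) with u <? v | adj G u v Bool.≟ true
  ... | yes u<v | yes uv = edge u v u<v uv ∷ []
  ... | _       | _      = []

  ∈-edgesBetween : ∀ e → e ∈ edgesBetween (src e , tgt e)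
  ∈-edgesBetween e with src e <? tgt e | adj G (src e) (tgt e) Bool.≟ true
  ... | yes p | yes q = here (edge-≡ e p q)
  ... | no ¬p | _     = contradiction (ord e) ¬p
  ... | yes _ | no ¬q = contradiction (isAdj e) ¬q

  allEdges : List (Edge G)
  allEdges = concatMap edgesBetween (cartesianProduct (allFin n) (allFin n))

  ∈-allEdges : ∀ e → e ∈ allEdges
  ∈-allEdges e = ∈-concatMap⁺ edgesBetween
    (lose (∈-cartesianProduct⁺ (∈-allFin (src e)) (∈-allFin (tgt e))) (∈-edgesBetween e))

  maximal-extension : (P : VSet n → ESet G → Set) →
    (∀ v W F → W v ≡ false → P W F → P (insV v W) F) →
    (∀ e W F → P W F → P W (insE e F)) →
    ∀ {W F} → IsUtterClique G W F → P W F →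
    DoubleNegation (∃ λ W′ → ∃ λ F′ → IsMaximalUtterClique G W′ F′ × P W′ F′)
  maximal-extension P P-insV P-insE {W} {F} cWF pWF = do
    (W₁ , _ , cW₁F , pW₁F , satV) ← Vertices.saturate (allFin n) W cWF pWF
    (F₂ , F⊆F₂ , cW₁F₂ , pW₁F₂ , satE) ← Edges.saturate W₁ allEdges F cW₁F pW₁F
    pure (W₁ , F₂ ,
          (cW₁F₂ ,
           (λ v W₁v≡false c → satV v (∈-allFin v) W₁v≡false (IsUtterClique-anti ⊆-refl F⊆F₂ c)) ,
           (λ e F₂e≡false → satE e (∈-allEdges e) F₂e≡false)) ,
          pW₁F₂)
    where
    module Vertices = Saturation insV insV-self ⊆-insV insV-mono
      (λ W′ → IsUtterClique G W′ F) (λ W⊆W′ → IsUtterClique-anti W⊆W′ ⊆-refl)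
      (λ W′ → P W′ F) (λ v W′ W′v≡false → P-insV v W′ F W′v≡false)
    module Edges (W′ : VSet n) = Saturation insE insE-self ⊆-insE insE-mono
      (λ F′ → IsUtterClique G W′ F′) (λ F⊆F′ → IsUtterClique-anti ⊆-refl F⊆F′)
      (λ F′ → P W′ F′) (λ e F′ _ → P-insE e W′ F′)

mainTheorem12 : ∀ {n} (G : Graph n) (W : VSet n) (F : ESet G) →
    IsUtterClique G W F → ¬ IsMaximalUtterClique G W F →
    (x : Fin n → ℚ) (y : Edge G → ℚ) → SatisfiesSystem G x y →
    cliqueLHS x y W F ≤ 1ℚ
mainTheorem12 G W F cWF _ x y (maximal≤1 , δ≤x , y≥0) =
  decidable-stable (cliqueLHS x y W F ≤? 1ℚ)
    (¬¬-map (λ (W′ , F′ , maxW′F′ , L≤L′) → ≤-trans L≤L′ (maximal≤1 W′ F′ maxW′F′))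
      (maximal-extension G (λ W′ F′ → cliqueLHS x y W F ≤ cliqueLHS x y W′ F′)
        (λ v W′ F′ W′v≡false L≤L′ →
           ≤-trans L≤L′ (cliqueLHS-insV x y y≥0 W′ F′ v W′v≡false (δ≤x v)))
        (λ e W′ F′ L≤L′ → ≤-trans L≤L′ (cliqueLHS-monoʳ x y y≥0 W′ (⊆-insE e F′)))
        cWF ≤-refl))
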